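{- Let $m$ be a refinement mapping from a high-level BAT $\mathcal{D}_h$ to a low-level BAT $\mathcal{D}_l$, and suppose that for any distinct ground high-level action terms $\alpha$ and $\alpha'$: (a) $\mathcal{D}_l\cup\mathcal{C}\models\forall s,s'.\,Do(m(\alpha),s,s')\supset\neg\exists\delta.\,Trans^*(m(\alpha'),s,\delta,s')$; (b) $\mathcal{D}_l\cup\mathcal{C}\models\forall s,s'.\,Do(m(\alpha),s,s')\supset\neg\exists a\exists\delta.\,Trans^*(m(\alpha),s,\delta,do(a,s'))$; (c) $\mathcal{D}_l\cup\mathcal{C}\models\forall s,s'.\,Do(m(\alpha),s,s')\supset s<s'$. Let $M_l$ be a model of $\mathcal{D}_l\cup\mathcal{C}$. Then for any ground situation terms $S_s$ and $S_e$ such that $M_l\models Do(\textsc{anyseqhl},S_s,S_e)$, there exists a unique ground high-level action sequence $\vec\alpha$ such that $M_l\models Do(m(\vec\alpha),S_s,S_e)$.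
   Context: Situation calculus setting. The object sort consists of a countably infinite set $\mathcal{N}$ of standard names (unique names and domain closure for objects); there are no function symbols other than constants and no non-fluent predicates. Situations are built from the initial situation $S_0$ with $do(a,s)$; $do([a_1,\dots,a_n],s)$ abbreviates $do(a_n,\dots,do(a_1,s)\dots)$, also written $do(\vec a,s)$; $\epsilon$ is the empty sequence. Fluents are predicates whose last argument is a situation. $Poss(a,s)$ means $a$ is executable in $s$; $Executable(s)$ means every action along the history from $S_0$ to $s$ was possible where performed; $s<s'$ means $s'$ is obtained from $s$ by a nonempty sequence of actions each possible where performed, and $s\le s'$ means $s=s'\lor s<s'$. A formula is uniform in $s$ if it does not mention $Poss$ or $\sqsubset$, does not quantify over situations, does not use equality on situations, and its only situation term in fluent situation-argument positions is $s$. A basic action theory (BAT) over finitely many action types $\mathcal{A}$ and fluents $\mathcal{F}$ is the union of: $\mathcal{D}_{S_0}$ (first-order axioms about $S_0$); $\mathcal{D}_{poss}$, one axiom $Poss(A(\vec x),s)\equiv\phi^{Poss}_A(\vec x,s)$ per action type, uniform in $s$; $\mathcal{D}_{ssa}$, one successor state axiom $F(\vec x,do(a,s))\equiv\phi^{ssa}_F(\vec x,a,s)$ per fluent, uniform in $s$; $\mathcal{D}_{ca}$, unique names for actions and domain closure on action types; $\mathcal{D}_{coa}$, unique names and domain closure for the constants in $\mathcal{N}$; and $\Sigma$, the foundational axioms of the situation calculus. A situation-suppressed formula omits situation arguments of fluents; $\phi[s]$ restores $s$. ConGolog programs: $\delta::=\alpha\mid\varphi?\mid\delta_1;\delta_2\mid\delta_1|\delta_2\mid\pi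 x.\delta\mid\delta^*\mid\delta_1\|\delta_2$; $nil$ abbreviates $True?$. Programs are encoded as terms and $\mathcal{C}$ denotes the axioms: $Trans(\alpha,s,\delta',s')\equiv s'=do(\alpha,s)\land Poss(\alpha,s)\land\delta'=True?$; $Trans(\varphi?,s,\delta',s')\equiv False$; $Trans(\delta_1;\delta_2,s,\delta',s')\equiv\exists\delta_1'(Trans(\delta_1,s,\delta_1',s')\land\delta'=\delta_1';\delta_2)\lor(Final(\delta_1,s)\land Trans(\delta_2,s,\delta',s'))$; $Trans(\delta_1|\delta_2,s,\delta',s')\equiv Trans(\delta_1,s,\delta',s')\lor Trans(\delta_2,s,\delta',s')$; $Trans(\pi x.\delta,s,\delta',s')\equiv\exists x.Trans(\delta,s,\delta',s')$; $Trans(\delta^*,s,\delta',s')\equiv\exists\delta''(Trans(\delta,s,\delta'',s')\land\delta'=\delta'';\delta^*)$; $Trans(\delta_1\|\delta_2,s,\delta',s')\equiv\exists\delta_1'(Trans(\delta_1,s,\delta_1',s')\land\delta'=\delta_1'\|\delta_2)\lor\exists\delta_2'(Trans(\delta_2,s,\delta_2',s')\land\delta'=\delta_1\|\delta_2')$; $Final(\alpha,s)\equiv False$; $Final(\varphi?,s)\equiv\varphi[s]$; $Final(\delta_1;\delta_2,s)\equiv Final(\delta_1,s)\land Final(\delta_2,s)$; $Final(\delta_1|\delta_2,s)\equiv Final(\delta_1,s)\lor Final(\delta_2,s)$; $Final(\pi x.\delta,s)\equiv\exists x.Final(\delta,s)$; $Final(\delta^*,s)\equiv True$; $Final(\delta_1\|\delta_2,s)\equiv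 Final(\delta_1,s)\land Final(\delta_2,s)$. $Trans^*$ is the reflexive transitive closure of $Trans$, and $Do(\delta,s,s')\doteq\exists\delta'.Trans^*(\delta,s,\delta',s')\land Final(\delta',s')$. A program $\delta$ is situation-determined in $s$ if $Trans^*(\delta,s,\delta',s')\land Trans^*(\delta,s,\delta'',s')$ implies $\delta'=\delta''$. Refinement mapping: $\mathcal{D}_h$, $\mathcal{D}_l$ are BATs with action types $\mathcal{A}_h,\mathcal{A}_l$ and fluents $\mathcal{F}_h,\mathcal{F}_l$, sharing no domain-specific symbols except $\mathcal{N}$. $m$ assigns to each $A\in\mathcal{A}_h$ a situation-determined ConGolog program $m(A(\vec x))$ over the language of $\mathcal{D}_l$ with free variables $\vec x$, and to each $F\in\mathcal{F}_h$ a situation-suppressed low-level formula $m(F(\vec x))$ with free variables $\vec x$; $m(\phi)$ substitutes $m(F(\vec x))$ for fluent atoms; $m(\alpha_1,\dots,\alpha_n)=m(\alpha_1);\dots;m(\alpha_n)$, $m(\epsilon)=nil$. $\textsc{any1hl}\doteq|_{A_i\in\mathcal{A}_h}\pi\vec x.\,m(A_i(\vec x))$ and $\textsc{anyseqhl}\doteq\textsc{any1hl}^*$. -}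

module Defs where

open import Data.Nat using (ℕ; zero; suc; _<_; _≟_)
open import Data.Fin using (Fin; toℕ)
open import Data.Vec using (Vec; []; _∷_; tabulate)
import Data.Vec as V
open import Data.Vec.Relation.Unary.Any using (Any)
open import Data.List using (List; []; _∷_; allFin)
import Data.List as List
open import Data.Product using (Σ; _×_; _,_)
open import Data.Sum using (_⊎_)
open import Data.Empty using (⊥)
open import Data.Unit using (⊤)
open import Relation.Nullary using (¬_; yes; no)
open import Relation.Binary.PropositionalEquality using (_≡_; _≢_)
open import Function.Bundles using (_⇔_)

record Sig : Set where
  field
    nA  : ℕ
    arA : Fin nA → ℕ
    nF  : ℕ
    arF : Fin nF → ℕ
open Sig public

data Term : Set where
  var : ℕ → Term
  nm  : ℕ → Term

substT : ℕ → ℕ → Term → Term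
substT x n (var y) with y ≟ x
... | yes _ = nm n
... | no  _ = var y
substT x n (nm k) = nm k

OFreeT : ℕ → Term → Set
OFreeT x (var y) = y ≡ x
OFreeT x (nm _)  = ⊥

evalT : (ℕ → ℕ) → Term → ℕ
evalT ρ (var y) = ρ y
evalT ρ (nm k)  = k

update : {A : Set} → (ℕ → A) → ℕ → A → ℕ → A
update ρ x v y with y ≟ x
... | yes _ = v
... | no  _ = ρ y

module _ (L : Sig) where

  -- Syntax: situation-suppressed (uniform) formulas, with object and
  -- action variables, and ConGolog programs.

  data ATerm : Set where
    avar : ℕ → ATerm
    acon : (A : Fin (nA L)) → Vec Term (arA L A) → ATerm

  data Formula : Set where
    ⊤f ⊥f : Formula
    atom  : (F : Fin (nF L)) → Vec Term (arF L F) → Formula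
    _≐_   : Term → Term → Formula
    _≐ₐ_  : ATerm → ATerm → Formula
    ¬f_   : Formula → Formula
    _∧f_ _∨f_ _⇒f_ : Formula → Formula → Formula
    ∃o ∀o : ℕ → Formula → Formula
    ∃a ∀a : ℕ → Formula → Formula

  data Prog : Set where
    act  : (A : Fin (nA L)) → Vec Term (arA L A) → Prog
    _¿   : Formula → Prog
    _⨟_  : Prog → Prog → Prog
    _∣_  : Prog → Prog → Prog
    π    : ℕ → Prog → Prog
    _⋆   : Prog → Prog
    _∥_  : Prog → Prog → Prog

  nil : Prog
  nil = ⊤f ¿

  substA : ℕ → ℕ → ATerm → ATerm
  substA x n (avar y)    = avar y
  substA x n (acon A ts) = acon A (V.map (substT x n) ts)

  substF : ℕ → ℕ → Formula → Formula
  substF x n ⊤f = ⊤f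
  substF x n ⊥f = ⊥f
  substF x n (atom F ts) = atom F (V.map (substT x n) ts)
  substF x n (t ≐ u) = substT x n t ≐ substT x n u
  substF x n (a ≐ₐ b) = substA x n a ≐ₐ substA x n b
  substF x n (¬f φ) = ¬f substF x n φ
  substF x n (φ ∧f ψ) = substF x n φ ∧f substF x n ψ
  substF x n (φ ∨f ψ) = substF x n φ ∨f substF x n ψ
  substF x n (φ ⇒f ψ) = substF x n φ ⇒f substF x n ψ
  substF x n (∃o y φ) with y ≟ x
  ... | yes _ = ∃o y φ
  ... | no  _ = ∃o y (substF x n φ)
  substF x n (∀o y φ) with y ≟ x
  ... | yes _ = ∀o y φ
  ... | no  _ = ∀o y (substF x n φ)
  substF x n (∃a y φ) = ∃a y (substF x n φ)
  substF x n (∀a y φ) = ∀a y (substF x n φ)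

  substP : ℕ → ℕ → Prog → Prog
  substP x n (act A ts) = act A (V.map (substT x n) ts)
  substP x n (φ ¿) = substF x n φ ¿
  substP x n (δ₁ ⨟ δ₂) = substP x n δ₁ ⨟ substP x n δ₂
  substP x n (δ₁ ∣ δ₂) = substP x n δ₁ ∣ substP x n δ₂
  substP x n (π y δ) with y ≟ x
  ... | yes _ = π y δ
  ... | no  _ = π y (substP x n δ)
  substP x n (δ ⋆) = substP x n δ ⋆
  substP x n (δ₁ ∥ δ₂) = substP x n δ₁ ∥ substP x n δ₂

  instFrom : {k : ℕ} → ℕ → Vec ℕ k → Prog → Prog
  instFrom i []       δ = δ
  instFrom i (n ∷ ns) δ = instFrom (suc i) ns (substP i n δ)

  πFrom : ℕ → ℕ → Prog → Prog
  πFrom i zero    δ = δ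
  πFrom i (suc k) δ = π i (πFrom (suc i) k δ)

  OFreeA : ℕ → ATerm → Set
  OFreeA x (avar _)    = ⊥
  OFreeA x (acon A ts) = Any (OFreeT x) ts

  AFreeA : ℕ → ATerm → Set
  AFreeA y (avar z)    = z ≡ y
  AFreeA y (acon A ts) = ⊥

  OFreeF : ℕ → Formula → Set
  OFreeF x ⊤f = ⊥
  OFreeF x ⊥f = ⊥
  OFreeF x (atom F ts) = Any (OFreeT x) ts
  OFreeF x (t ≐ u) = OFreeT x t ⊎ OFreeT x u
  OFreeF x (a ≐ₐ b) = OFreeA x a ⊎ OFreeA x b
  OFreeF x (¬f φ) = OFreeF x φ
  OFreeF x (φ ∧f ψ) = OFreeF x φ ⊎ OFreeF x ψ
  OFreeF x (φ ∨f ψ) = OFreeF x φ ⊎ OFreeF x ψ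
  OFreeF x (φ ⇒f ψ) = OFreeF x φ ⊎ OFreeF x ψ
  OFreeF x (∃o y φ) = y ≢ x × OFreeF x φ
  OFreeF x (∀o y φ) = y ≢ x × OFreeF x φ
  OFreeF x (∃a y φ) = OFreeF x φ
  OFreeF x (∀a y φ) = OFreeF x φ

  AFreeF : ℕ → Formula → Set
  AFreeF x ⊤f = ⊥
  AFreeF x ⊥f = ⊥
  AFreeF x (atom F ts) = ⊥
  AFreeF x (t ≐ u) = ⊥
  AFreeF x (a ≐ₐ b) = AFreeA x a ⊎ AFreeA x b
  AFreeF x (¬f φ) = AFreeF x φ
  AFreeF x (φ ∧f ψ) = AFreeF x φ ⊎ AFreeF x ψ
  AFreeF x (φ ∨f ψ) = AFreeF x φ ⊎ AFreeF x ψ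
  AFreeF x (φ ⇒f ψ) = AFreeF x φ ⊎ AFreeF x ψ
  AFreeF x (∃o y φ) = AFreeF x φ
  AFreeF x (∀o y φ) = AFreeF x φ
  AFreeF x (∃a y φ) = y ≢ x × AFreeF x φ
  AFreeF x (∀a y φ) = y ≢ x × AFreeF x φ

  OFreeP : ℕ → Prog → Set
  OFreeP x (act A ts) = Any (OFreeT x) ts
  OFreeP x (φ ¿) = OFreeF x φ
  OFreeP x (δ₁ ⨟ δ₂) = OFreeP x δ₁ ⊎ OFreeP x δ₂
  OFreeP x (δ₁ ∣ δ₂) = OFreeP x δ₁ ⊎ OFreeP x δ₂
  OFreeP x (π y δ) = y ≢ x × OFreeP x δ
  OFreeP x (δ ⋆) = OFreeP x δ
  OFreeP x (δ₁ ∥ δ₂) = OFreeP x δ₁ ⊎ OFreeP x δ₂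

  AFreeP : ℕ → Prog → Set
  AFreeP x (act A ts) = ⊥
  AFreeP x (φ ¿) = AFreeF x φ
  AFreeP x (δ₁ ⨟ δ₂) = AFreeP x δ₁ ⊎ AFreeP x δ₂
  AFreeP x (δ₁ ∣ δ₂) = AFreeP x δ₁ ⊎ AFreeP x δ₂
  AFreeP x (π y δ) = AFreeP x δ
  AFreeP x (δ ⋆) = AFreeP x δ
  AFreeP x (δ₁ ∥ δ₂) = AFreeP x δ₁ ⊎ AFreeP x δ₂

  FreeWithinF : ℕ → ℕ → Formula → Set
  FreeWithinF k j φ = (∀ x → OFreeF x φ → x < k) × (∀ y → AFreeF y φ → y < j)

  FreeWithinP : ℕ → Prog → Set
  FreeWithinP k δ = (∀ x → OFreeP x δ → x < k) × (∀ y → ¬ AFreeP y δ)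

  -- Objects = standard names ℕ; ground actions A(n⃗)
  -- (unique names + domain closure for actions); situations = finite
  -- action sequences, most recent first: S0 = [], do(a,s) = a ∷ s.

  Act : Set
  Act = Σ (Fin (nA L)) (λ A → Vec ℕ (arA L A))

  Sit : Set
  Sit = List Act

  S0 : Sit
  S0 = []

  State : Set₁
  State = (F : Fin (nF L)) → Vec ℕ (arF L F) → Set

  evalA : (ℕ → ℕ) → (ℕ → Act) → ATerm → Act
  evalA ρ σ (avar y)    = σ y
  evalA ρ σ (acon A ts) = A , V.map (evalT ρ) ts

  ⟦_⟧ : Formula → (ℕ → ℕ) → (ℕ → Act) → State → Set
  ⟦ ⊤f ⟧ ρ σ w = ⊤
  ⟦ ⊥f ⟧ ρ σ w = ⊥
  ⟦ atom F ts ⟧ ρ σ w = w F (V.map (evalT ρ) ts)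
  ⟦ t ≐ u ⟧ ρ σ w = evalT ρ t ≡ evalT ρ u
  ⟦ a ≐ₐ b ⟧ ρ σ w = evalA ρ σ a ≡ evalA ρ σ b
  ⟦ ¬f φ ⟧ ρ σ w = ¬ ⟦ φ ⟧ ρ σ w
  ⟦ φ ∧f ψ ⟧ ρ σ w = ⟦ φ ⟧ ρ σ w × ⟦ ψ ⟧ ρ σ w
  ⟦ φ ∨f ψ ⟧ ρ σ w = ⟦ φ ⟧ ρ σ w ⊎ ⟦ ψ ⟧ ρ σ w
  ⟦ φ ⇒f ψ ⟧ ρ σ w = ⟦ φ ⟧ ρ σ w → ⟦ ψ ⟧ ρ σ w
  ⟦ ∃o x φ ⟧ ρ σ w = Σ ℕ (λ n → ⟦ φ ⟧ (update ρ x n) σ w)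
  ⟦ ∀o x φ ⟧ ρ σ w = (n : ℕ) → ⟦ φ ⟧ (update ρ x n) σ w
  ⟦ ∃a y φ ⟧ ρ σ w = Σ Act (λ a → ⟦ φ ⟧ ρ (update σ y a) w)
  ⟦ ∀a y φ ⟧ ρ σ w = (a : Act) → ⟦ φ ⟧ ρ (update σ y a) w

  argsOf : (ℕ → ℕ) → (k : ℕ) → Vec ℕ k
  argsOf ρ k = tabulate (λ i → ρ (toℕ i))

  record Structure : Set₁ where
    field
      fluent : Sit → State
      Poss   : Act → Sit → Set
  open Structure public

  -- a basic action theory (D_ca, D_coa, Σ are built into the semantics)
  record BAT : Set₁ where
    field
      DS0      : Formula → Set
      possF    : (A : Fin (nA L)) → Formula
      possF-wf : ∀ A → FreeWithinF (arA L A) 0 (possF A)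
      ssaF     : (F : Fin (nF L)) → Formula
      ssaF-wf  : ∀ F → FreeWithinF (arF L F) 1 (ssaF F)
  open BAT public

  -- M is a model of D (axioms read with universal closure)
  record IsModel (D : BAT) (M : Structure) : Set where
    field
      initial : ∀ φ → DS0 D φ → ∀ ρ σ → ⟦ φ ⟧ ρ σ (fluent M S0)
      precond : ∀ A ρ σ s →
                Poss M (A , argsOf ρ (arA L A)) s ⇔ ⟦ possF D A ⟧ ρ σ (fluent M s)
      succ    : ∀ F ρ σ s →
                fluent M (σ 0 ∷ s) F (argsOf ρ (arF L F)) ⇔ ⟦ ssaF D F ⟧ ρ σ (fluent M s)

  module _ (M : Structure) where

    data _<ₛ_ : Sit → Sit → Set where
      <-one  : ∀ {a s} → Poss M a s → s <ₛ (a ∷ s)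
      <-more : ∀ {a s s'} → s <ₛ s' → Poss M a s' → s <ₛ (a ∷ s')

    data Final : Prog → Sit → Set where
      f-test : ∀ {φ s} → (∀ ρ σ → ⟦ φ ⟧ ρ σ (fluent M s)) → Final (φ ¿) s
      f-seq  : ∀ {δ₁ δ₂ s} → Final δ₁ s → Final δ₂ s → Final (δ₁ ⨟ δ₂) s
      f-ch₁  : ∀ {δ₁ δ₂ s} → Final δ₁ s → Final (δ₁ ∣ δ₂) s
      f-ch₂  : ∀ {δ₁ δ₂ s} → Final δ₂ s → Final (δ₁ ∣ δ₂) s
      f-π    : ∀ {x δ s} (n : ℕ) → Final (substP x n δ) s → Final (π x δ) s
      f-star : ∀ {δ s} → Final (δ ⋆) s
      f-par  : ∀ {δ₁ δ₂ s} → Final δ₁ s → Final δ₂ s → Final (δ₁ ∥ δ₂) s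

    data Trans : Prog → Sit → Prog → Sit → Set where
      t-act  : ∀ {A ts ns s} → ts ≡ V.map nm ns → Poss M (A , ns) s →
               Trans (act A ts) s nil ((A , ns) ∷ s)
      t-seq₁ : ∀ {δ₁ δ₂ δ₁' s s'} → Trans δ₁ s δ₁' s' →
               Trans (δ₁ ⨟ δ₂) s (δ₁' ⨟ δ₂) s'
      t-seq₂ : ∀ {δ₁ δ₂ δ' s s'} → Final δ₁ s → Trans δ₂ s δ' s' →
               Trans (δ₁ ⨟ δ₂) s δ' s'
      t-ch₁  : ∀ {δ₁ δ₂ δ' s s'} → Trans δ₁ s δ' s' → Trans (δ₁ ∣ δ₂) s δ' s'
      t-ch₂  : ∀ {δ₁ δ₂ δ' s s'} → Trans δ₂ s δ' s' → Trans (δ₁ ∣ δ₂) s δ' s'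
      t-π    : ∀ {x δ δ' s s'} (n : ℕ) → Trans (substP x n δ) s δ' s' →
               Trans (π x δ) s δ' s'
      t-star : ∀ {δ δ'' s s'} → Trans δ s δ'' s' → Trans (δ ⋆) s (δ'' ⨟ (δ ⋆)) s'
      t-par₁ : ∀ {δ₁ δ₂ δ₁' s s'} → Trans δ₁ s δ₁' s' →
               Trans (δ₁ ∥ δ₂) s (δ₁' ∥ δ₂) s'
      t-par₂ : ∀ {δ₁ δ₂ δ₂' s s'} → Trans δ₂ s δ₂' s' →
               Trans (δ₁ ∥ δ₂) s (δ₁ ∥ δ₂') s'

    data Trans* : Prog → Sit → Prog → Sit → Set where
      refl* : ∀ {δ s} → Trans* δ s δ s
      step* : ∀ {δ δ' δ'' s s' s''} → Trans δ s δ' s' → Trans* δ' s' δ'' s'' →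
              Trans* δ s δ'' s''

    Do : Prog → Sit → Sit → Set
    Do δ s s' = Σ Prog (λ δ' → Trans* δ s δ' s' × Final δ' s')

    SitDetermined : Prog → Sit → Set
    SitDetermined δ s = ∀ {δ' δ'' s'} → Trans* δ s δ' s' → Trans* δ s δ'' s' → δ' ≡ δ''

  -- nondeterministic choice over a list of programs (empty choice = False?)
  choice : List Prog → Prog
  choice []           = ⊥f ¿
  choice (δ ∷ [])     = δ
  choice (δ ∷ δ' ∷ r) = δ ∣ choice (δ' ∷ r)

module _ (Lh Ll : Sig) where

  record RefMap (Dh : BAT Lh) (Dl : BAT Ll) : Set₁ where
    field
      mA      : (A : Fin (nA Lh)) → Prog Ll
      mA-free : ∀ A → FreeWithinP Ll (arA Lh A) (mA A)
      mA-sd   : ∀ (M : Structure Ll) → IsModel Ll Dl M →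
                ∀ A (ns : Vec ℕ (arA Lh A)) s →
                SitDetermined Ll M (instFrom Ll 0 ns (mA A)) s
      mF      : (F : Fin (nF Lh)) → Formula Ll
      mF-free : ∀ F → FreeWithinF Ll (arF Lh F) 0 (mF F)

  module _ {Dh : BAT Lh} {Dl : BAT Ll} (m : RefMap Dh Dl) where
    open RefMap m

    mAct : Act Lh → Prog Ll
    mAct (A , ns) = instFrom Ll 0 ns (mA A)

    mSeq : List (Act Lh) → Prog Ll
    mSeq []           = nil Ll
    mSeq (α ∷ [])     = mAct α
    mSeq (α ∷ α' ∷ r) = mAct α ⨟ mSeq (α' ∷ r)

    any1hl : Prog Ll
    any1hl = choice Ll (List.map (λ A → πFrom Ll 0 (arA Lh A) (mA A)) (allFin (nA Lh)))

    anyseqhl : Prog Ll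
    anyseqhl = any1hl ⋆

module Submission where

open import Defs
open import Data.List using (List; _∷_; []; length; allFin)
import Data.List as List
open import Data.List.Relation.Binary.Suffix.Heterogeneous using (Suffix; here; there; tail)
import Data.List.Relation.Binary.Suffix.Heterogeneous.Properties as Suffix
open import Data.List.Relation.Binary.Pointwise using (Pointwise-≡⇒≡; ≡⇒Pointwise-≡)
open import Data.Product using (Σ; ∃; _×_; _,_)
open import Data.Sum using (_⊎_; inj₁; inj₂)
open import Data.Empty using (⊥-elim)
open import Data.Unit using (tt)
import Data.Fin.Properties as Fin
open import Data.Vec using (Vec; []; _∷_)
import Data.Vec.Properties as Vec
import Data.Product.Properties as Product
open import Data.Nat using (ℕ; zero; suc; _<_; _≟_)
open import Data.Nat.Properties using (≤-refl; <-irrefl; m≤n⇒m≤1+n)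
open import Relation.Nullary using (¬_; yes; no)
open import Relation.Binary.Definitions using (DecidableEquality)
open import Relation.Binary.PropositionalEquality
  using (_≡_; _≢_; refl; cong; subst)
import Relation.Binary.PropositionalEquality as ≡

-- A complete run of anyseqhl is a chain of complete runs of programs m(α), one after
-- another: each pass through any1hl commits with its first transition to one m(α), the
-- π-bound arguments being fixed at that point, and the pass may end as soon as that
-- program is final.  This gives existence.  For uniqueness, (a) and (b) say that the end
-- situations of complete runs of the m(α) from a common situation form a prefix-free set:
-- if a run of m(α) from s ends at a subhistory of the end of a run of m(β) from s, then the
-- prefix of the longer run contradicts (a) unless α = β, and contradicts (b) unless the end
-- points coincide.  By (c) every such run performs at least one action, so two chains
-- between the same situations decompose the same history the same way, as words over a
-- prefix code do.

-- The situation-calculus subhistory relation s ⊑ s' (no executability required):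
-- situations list their actions most recent first, so it is the suffix order.
module _ {A : Set} where

  infix 4 _⊑_

  _⊑_ : List A → List A → Set
  _⊑_ = Suffix _≡_

  ⊑-refl : ∀ {xs} → xs ⊑ xs
  ⊑-refl = here (≡⇒Pointwise-≡ refl)

  ⊑-trans : ∀ {xs ys zs} → xs ⊑ ys → ys ⊑ zs → xs ⊑ zs
  ⊑-trans = Suffix.trans ≡.trans

  ∷-⋢ : ∀ {x xs} → ¬ (x ∷ xs) ⊑ xs
  ∷-⋢ p = Suffix.S[as][bs]⇒∣as∣≢1+∣bs∣ p refl

  ⊑-total : ∀ {xs ys zs} → xs ⊑ zs → ys ⊑ zs → xs ⊑ ys ⊎ ys ⊑ xs
  ⊑-total (here p)  q with refl ← Pointwise-≡⇒≡ p = inj₂ q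
  ⊑-total (there p) (here q) with refl ← Pointwise-≡⇒≡ q = inj₁ (there p)
  ⊑-total (there p) (there q) = ⊑-total p q

  ⊑-length-injective : ∀ {xs ys zs} → xs ⊑ zs → ys ⊑ zs →
                       length xs ≡ length ys → xs ≡ ys
  ⊑-length-injective p q eq with ⊑-total p q
  ... | inj₁ xs⊑ys = Pointwise-≡⇒≡ (Suffix.toPointwise eq xs⊑ys)
  ... | inj₂ ys⊑xs = ≡.sym (Pointwise-≡⇒≡ (Suffix.toPointwise (≡.sym eq) ys⊑xs))

  ⊑-split : ∀ {xs ys} → xs ⊑ ys → xs ≡ ys ⊎ ∃ λ x → (x ∷ xs) ⊑ ys
  ⊑-split (here p) = inj₁ (Pointwise-≡⇒≡ p)
  ⊑-split (there p) with ⊑-split p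
  ... | inj₁ refl       = inj₂ (_ , ⊑-refl)
  ... | inj₂ (x , x∷xs⊑) = inj₂ (x , there x∷xs⊑)

module Runs (L : Sig) (M : Structure L) where

  <ₛ⇒∷⊑ : ∀ {s s'} → _<ₛ_ L M s s' → ∃ λ a → (a ∷ s) ⊑ s'
  <ₛ⇒∷⊑ (<-one _)    = _ , ⊑-refl
  <ₛ⇒∷⊑ (<-more p _) with a , a∷s⊑ ← <ₛ⇒∷⊑ p = a , there a∷s⊑

  Trans⇒∷ : ∀ {δ s δ' s'} → Trans L M δ s δ' s' → ∃ λ a → s' ≡ a ∷ s
  Trans⇒∷ (t-act _ _)  = _ , refl
  Trans⇒∷ (t-seq₁ t)   = Trans⇒∷ t
  Trans⇒∷ (t-seq₂ _ t) = Trans⇒∷ t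
  Trans⇒∷ (t-ch₁ t)    = Trans⇒∷ t
  Trans⇒∷ (t-ch₂ t)    = Trans⇒∷ t
  Trans⇒∷ (t-π _ t)    = Trans⇒∷ t
  Trans⇒∷ (t-star t)   = Trans⇒∷ t
  Trans⇒∷ (t-par₁ t)   = Trans⇒∷ t
  Trans⇒∷ (t-par₂ t)   = Trans⇒∷ t

  Trans*⇒⊑ : ∀ {δ s δ' s'} → Trans* L M δ s δ' s' → s ⊑ s'
  Trans*⇒⊑ refl*        = ⊑-refl
  Trans*⇒⊑ (step* t r) with _ , refl ← Trans⇒∷ t = tail (Trans*⇒⊑ r)

  Trans*-prefix : ∀ {δ s δ' s' S} → Trans* L M δ s δ' s' → s ⊑ S → S ⊑ s' →
                  ∃ λ δ'' → Trans* L M δ s δ'' S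
  Trans*-prefix refl* s⊑S S⊑s
    with refl ← Pointwise-≡⇒≡ (Suffix.antisym (λ e _ → e) s⊑S S⊑s) = _ , refl*
  Trans*-prefix (step* t r) s⊑S S⊑s' with ⊑-split s⊑S | Trans⇒∷ t
  ... | inj₁ refl        | _ = _ , refl*
  ... | inj₂ (b , b∷s⊑S) | a , refl
    with refl ← ⊑-length-injective (⊑-trans b∷s⊑S S⊑s') (Trans*⇒⊑ r) refl
    with δ'' , r' ← Trans*-prefix r b∷s⊑S S⊑s' = δ'' , step* t r'

  Trans*-++ : ∀ {δ s δ' s' δ'' s''} → Trans* L M δ s δ' s' → Trans* L M δ' s' δ'' s'' →
              Trans* L M δ s δ'' s''
  Trans*-++ refl*       r' = r'
  Trans*-++ (step* t r) r' = step* t (Trans*-++ r r')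

  Trans*-snoc : ∀ {δ s δ' s' δ'' s''} → Trans* L M δ s δ' s' → Trans L M δ' s' δ'' s'' →
                Trans* L M δ s δ'' s''
  Trans*-snoc r t = Trans*-++ r (step* t refl*)

  Trans*-⨟ : ∀ {δ₁ δ₂ s δ₁' s'} → Trans* L M δ₁ s δ₁' s' →
             Trans* L M (δ₁ ⨟ δ₂) s (δ₁' ⨟ δ₂) s'
  Trans*-⨟ refl*       = refl*
  Trans*-⨟ (step* t r) = step* (t-seq₁ t) (Trans*-⨟ r)

  Do-nil : ∀ {s} → Do L M (nil L) s s
  Do-nil = _ , refl* , f-test (λ _ _ → tt)

  Do-nil⁻ : ∀ {s s'} → Do L M (nil L) s s' → s ≡ s'
  Do-nil⁻ (_ , refl* , _) = refl
  Do-nil⁻ (_ , step* () _ , _)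

  Do-⨟ : ∀ {δ₁ δ₂ s S s'} → Do L M δ₁ s S → Do L M δ₂ S s' → Do L M (δ₁ ⨟ δ₂) s s'
  Do-⨟ (_ , r₁ , f₁) (_ , refl* , f₂)        = _ , Trans*-⨟ r₁ , f-seq f₁ f₂
  Do-⨟ (_ , r₁ , f₁) (δ₂' , step* t r₂ , f₂) =
    δ₂' , Trans*-++ (Trans*-⨟ r₁) (step* (t-seq₂ f₁ t) r₂) , f₂

  Do-⨟⁻ : ∀ {δ₁ δ₂ s s'} → Do L M (δ₁ ⨟ δ₂) s s' →
          ∃ λ S → Do L M δ₁ s S × Do L M δ₂ S s'
  Do-⨟⁻ (_ , r , f) = split refl* r f
    where
    split : ∀ {δ₁ δ₂ s δ₁' S γ s'} → Trans* L M δ₁ s δ₁' S →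
            Trans* L M (δ₁' ⨟ δ₂) S γ s' → Final L M γ s' →
            ∃ λ S' → Do L M δ₁ s S' × Do L M δ₂ S' s'
    split r₁ refl* (f-seq f₁ f₂)         = _ , (_ , r₁ , f₁) , (_ , refl* , f₂)
    split r₁ (step* (t-seq₁ t) r) f      = split (Trans*-snoc r₁ t) r f
    split r₁ (step* (t-seq₂ f₁ t) r) f = _ , (_ , r₁ , f₁) , (_ , step* t r , f)

  substP-πFrom : ∀ x n j k δ → x < j →
                 substP L x n (πFrom L j k δ) ≡ πFrom L j k (substP L x n δ)
  substP-πFrom x n j zero    δ _   = refl
  substP-πFrom x n j (suc k) δ x<j with j ≟ x
  ... | yes refl = ⊥-elim (<-irrefl refl x<j)
  ... | no _     = cong (π j) (substP-πFrom x n (suc j) k δ (m≤n⇒m≤1+n x<j))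

  Trans-πFrom⁻ : ∀ i k δ {s γ s'} → Trans L M (πFrom L i k δ) s γ s' →
                 ∃ λ (ns : Vec ℕ k) → Trans L M (instFrom L i ns δ) s γ s'
  Trans-πFrom⁻ i zero    δ t         = [] , t
  Trans-πFrom⁻ i (suc k) δ (t-π n t)
    with ns , t' ← Trans-πFrom⁻ (suc i) k (substP L i n δ)
                     (subst (λ δ' → Trans L M δ' _ _ _) (substP-πFrom i n (suc i) k δ ≤-refl) t)
    = n ∷ ns , t'

  Trans-choice⁻ : ∀ {B : Set} (P : B → Prog L) (bs : List B) {s γ s'} →
                  Trans L M (choice L (List.map P bs)) s γ s' → ∃ λ b → Trans L M (P b) s γ s'
  Trans-choice⁻ P (b ∷ [])     t         = b , t
  Trans-choice⁻ P (b ∷ _ ∷ _)  (t-ch₁ t) = b , t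
  Trans-choice⁻ P (_ ∷ b ∷ bs) (t-ch₂ t) = Trans-choice⁻ P (b ∷ bs) t

  data Chain {B : Set} (P : B → Prog L) : List B → Sit L → Sit L → Set where
    []  : ∀ {s} → Chain P [] s s
    _∷_ : ∀ {β βs s S s'} → Do L M (P β) s S → Chain P βs S s' → Chain P (β ∷ βs) s s'

  module _ {B : Set} (P : B → Prog L) where

    Chain⇒⊑ : ∀ {βs s s'} → Chain P βs s s' → s ⊑ s'
    Chain⇒⊑ []                = ⊑-refl
    Chain⇒⊑ ((_ , r , _) ∷ c) = ⊑-trans (Trans*⇒⊑ r) (Chain⇒⊑ c)

    Do-⋆⇒Chain : ∀ {δ} → (∀ {s γ s'} → Trans L M δ s γ s' → ∃ λ β → Trans L M (P β) s γ s') →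
                 ∀ {s s'} → Do L M (δ ⋆) s s' → ∃ λ βs → Chain P βs s s'
    Do-⋆⇒Chain commit (_ , refl* , _) = [] , []
    Do-⋆⇒Chain {δ} commit (_ , step* (t-star t) r , f) with β , t' ← commit t =
      chainFrom (step* t' refl*) r f
      where
      chainFrom : ∀ {β s γ S δ' s'} → Trans* L M (P β) s γ S →
                  Trans* L M (γ ⨟ (δ ⋆)) S δ' s' → Final L M δ' s' →
                  ∃ λ βs → Chain P βs s s'
      chainFrom {β} run refl* (f-seq f _) = β ∷ [] , (_ , run , f) ∷ []
      chainFrom run (step* (t-seq₁ t) r) f = chainFrom (Trans*-snoc run t) r f
      chainFrom {β} run (step* (t-seq₂ fin (t-star t)) r) f
        with β' , t' ← commit t
        with βs , c ← chainFrom {β'} (step* t' refl*) r f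
        = β ∷ βs , (_ , run , fin) ∷ c

    PrefixFree : Set
    PrefixFree = ∀ α β {s S₁ S₂} → Do L M (P α) s S₁ → Do L M (P β) s S₂ → S₁ ⊑ S₂ →
                 α ≡ β × S₁ ≡ S₂

    Progressing : Set
    Progressing = ∀ β {s S} → Do L M (P β) s S → ¬ S ⊑ s

    Chain-unique : PrefixFree → Progressing →
                   ∀ {αs βs s s'} → Chain P αs s s' → Chain P βs s s' → βs ≡ αs
    Chain-unique free prog []      []      = refl
    Chain-unique free prog []      (d ∷ c) = ⊥-elim (prog _ d (Chain⇒⊑ c))
    Chain-unique free prog (d ∷ c) []      = ⊥-elim (prog _ d (Chain⇒⊑ c))
    Chain-unique free prog (d ∷ c) (e ∷ c') with ⊑-total (Chain⇒⊑ c) (Chain⇒⊑ c')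
    ... | inj₁ S₁⊑S₂ with refl , refl ← free _ _ d e S₁⊑S₂ = cong (_ ∷_) (Chain-unique free prog c c')
    ... | inj₂ S₂⊑S₁ with refl , refl ← free _ _ e d S₂⊑S₁ = cong (_ ∷_) (Chain-unique free prog c c')

module Refinement {Lh Ll : Sig} {Dh : BAT Lh} {Dl : BAT Ll} (m : RefMap Lh Ll Dh Dl)
                  (M : Structure Ll) where
  open RefMap m
  open Runs Ll M

  m[_] : Act Lh → Prog Ll
  m[_] = mAct Lh Ll m

  _≟ₐ_ : DecidableEquality (Act Lh)
  _≟ₐ_ = Product.≡-dec Fin._≟_ (Vec.≡-dec _≟_)

  Trans-any1hl⁻ : ∀ {s γ s'} → Trans Ll M (any1hl Lh Ll m) s γ s' →
                  ∃ λ α → Trans Ll M m[ α ] s γ s'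
  Trans-any1hl⁻ t
    with A , t' ← Trans-choice⁻ (λ A → πFrom Ll 0 (arA Lh A) (mA A)) (allFin (nA Lh)) t
    with ns , t'' ← Trans-πFrom⁻ 0 (arA Lh A) (mA A) t'
    = (A , ns) , t''

  Chain⇒Do-mSeq : ∀ {αs s s'} → Chain m[_] αs s s' → Do Ll M (mSeq Lh Ll m αs) s s'
  Chain⇒Do-mSeq []              = Do-nil
  Chain⇒Do-mSeq (d ∷ [])        = d
  Chain⇒Do-mSeq (d ∷ c@(_ ∷ _)) = Do-⨟ d (Chain⇒Do-mSeq c)

  Do-mSeq⇒Chain : ∀ αs {s s'} → Do Ll M (mSeq Lh Ll m αs) s s' → Chain m[_] αs s s'
  Do-mSeq⇒Chain []           d with refl ← Do-nil⁻ d = []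
  Do-mSeq⇒Chain (_ ∷ [])     d = d ∷ []
  Do-mSeq⇒Chain (_ ∷ α ∷ αs) d = let _ , d₁ , d₂ = Do-⨟⁻ d in d₁ ∷ Do-mSeq⇒Chain (α ∷ αs) d₂

  prefixFree : (∀ α α' → α ≢ α' → ∀ s s' → Do Ll M m[ α ] s s' →
                 ¬ ∃ λ δ → Trans* Ll M m[ α' ] s δ s') →
               (∀ α s s' → Do Ll M m[ α ] s s' →
                 ¬ ∃ λ a → ∃ λ δ → Trans* Ll M m[ α ] s δ (a ∷ s')) →
               PrefixFree m[_]
  prefixFree excl maximal α β {s} {S₁} d₁@(_ , r₁ , _) (_ , r₂ , _) S₁⊑S₂ with α ≟ₐ β
  ... | no α≢β = ⊥-elim (excl α β α≢β s S₁ d₁ (Trans*-prefix r₂ (Trans*⇒⊑ r₁) S₁⊑S₂))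
  ... | yes refl with ⊑-split S₁⊑S₂
  ...   | inj₁ S₁≡S₂        = refl , S₁≡S₂
  ...   | inj₂ (a , a∷S₁⊑S₂) = ⊥-elim (maximal α s S₁ d₁
            (a , Trans*-prefix r₂ (⊑-trans (Trans*⇒⊑ r₁) (there ⊑-refl)) a∷S₁⊑S₂))

  progressing : (∀ α s s' → Do Ll M m[ α ] s s' → _<ₛ_ Ll M s s') → Progressing m[_]
  progressing advances β {s} {S} d S⊑s with a , a∷s⊑S ← <ₛ⇒∷⊑ (advances β s S d) =
    ∷-⋢ (⊑-trans a∷s⊑S S⊑s)

theorem9 : (Lh Ll : Sig) (Dh : BAT Lh) (Dl : BAT Ll) (m : RefMap Lh Ll Dh Dl) →
    -- (a)
    (∀ (α α' : Act Lh) → α ≢ α' →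
      ∀ (M : Structure Ll) → IsModel Ll Dl M → ∀ (s s' : Sit Ll) →
      Do Ll M (mAct Lh Ll m α) s s' →
      ¬ Σ (Prog Ll) (λ δ → Trans* Ll M (mAct Lh Ll m α') s δ s')) →
    -- (b)
    (∀ (α : Act Lh) →
      ∀ (M : Structure Ll) → IsModel Ll Dl M → ∀ (s s' : Sit Ll) →
      Do Ll M (mAct Lh Ll m α) s s' →
      ¬ Σ (Act Ll) (λ a → Σ (Prog Ll) (λ δ → Trans* Ll M (mAct Lh Ll m α) s δ (a ∷ s')))) →
    -- (c)
    (∀ (α : Act Lh) →
      ∀ (M : Structure Ll) → IsModel Ll Dl M → ∀ (s s' : Sit Ll) →
      Do Ll M (mAct Lh Ll m α) s s' → _<ₛ_ Ll M s s') →
    ∀ (Ml : Structure Ll) → IsModel Ll Dl Ml →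
    ∀ (Ss Se : Sit Ll) → Do Ll Ml (anyseqhl Lh Ll m) Ss Se →
    Σ (List (Act Lh)) (λ αs →
      Do Ll Ml (mSeq Lh Ll m αs) Ss Se ×
      (∀ (βs : List (Act Lh)) → Do Ll Ml (mSeq Lh Ll m βs) Ss Se → βs ≡ αs))
theorem9 Lh Ll Dh Dl m excl maximal advances Ml model Ss Se d =
  let αs , chain = Do-⋆⇒Chain m[_] Trans-any1hl⁻ d
  in αs , Chain⇒Do-mSeq chain , λ βs dβ → Chain-unique m[_] free prog chain (Do-mSeq⇒Chain βs dβ)
  where
  open Runs Ll Ml
  open Refinement m Ml
  free : PrefixFree m[_]
  free = prefixFree (λ α α' α≢α' → excl α α' α≢α' Ml model) (λ α → maximal α Ml model)
  prog : Progressing m[_]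
  prog = progressing (λ α → advances α Ml model)
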